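{- Let $r<a$ be positive integers with $r\nmid a$, and let $R$ be a permutation of $[r]$ that is nice corresponding to $a$. Let $\overline{R}$ be the complement of $R$ and let $A$ be the extension sequence of $(\overline{R},a)$. Then $A$ is nice corresponding to every integer $b>a$ with $b\equiv r \pmod a$.
   Context: For a positive integer $m$, $[m]=\{0,1,\ldots,m-1\}$; a sequence of length $m$ has entries indexed by $[m]$, and $A(i)$ denotes its $i$-th entry. A permutation of $[m]$ is a sequence of length $m$ whose entries are $0,1,\ldots,m-1$ in some order. The complement of a permutation $A$ of $[m]$ is the permutation $\overline{A}$ of $[m]$ with $\overline{A}(i)=m-1-A(i)$. For positive integers $a<b$ and a permutation $A$ of $[a]$, the extension sequence of $(A,b)$ is the permutation $B$ of $[b]$ such that for all $i,j\in[b]$, $B(i)<B(j)$ if and only if $A(i_0)<A(j_0)$, or $A(i_0)=A(j_0)$ and $i<j$, where $i_0,j_0$ are the remainders of $i,j$ upon division by $a$. For positive integers $a<b$ with $a\nmid b$, let $r$ be the remainder of $b$ divided by $a$ and $d=\gcd(a,b)$; a permutation $A$ of $[a]$ is nice corresponding to $b$ if $A(i)<A(i+r)$ for $0\leq i\leq a-r-1$, and $A(j)<A(j-a+r)$ for $a-r\leq j\leq a-d-1$. -}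

module Defs where

open import Data.Nat using (ℕ; _<_; _≤_; _+_; _∸_; NonZero)
open import Data.Nat.DivMod using (_%_)
open import Data.Nat.GCD using (gcd)
open import Data.Nat.Divisibility using (_∣_)
open import Data.Product using (_×_)
open import Data.Sum using (_⊎_)
open import Relation.Binary.PropositionalEquality using (_≡_)
open import Relation.Nullary using (¬_)
open import Function.Bundles using (_⇔_)

-- A sequence of length m is represented as a function ℕ → ℕ of which only
-- the entries at indices 0..m-1 are relevant.

IsPermutation : ℕ → (ℕ → ℕ) → Set
IsPermutation m A =
  (∀ i → i < m → A i < m) ×
  (∀ i j → i < m → j < m → A i ≡ A j → i ≡ j)

complement : ℕ → (ℕ → ℕ) → (ℕ → ℕ)
complement m A i = m ∸ 1 ∸ A i

IsExtensionSequence : (a : ℕ) → .{{NonZero a}} → (A : ℕ → ℕ) → (b : ℕ) → (B : ℕ → ℕ) → Set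
IsExtensionSequence a A b B =
  IsPermutation b B ×
  (∀ i j → i < b → j < b →
     (B i < B j) ⇔ ((A (i % a) < A (j % a)) ⊎ ((A (i % a) ≡ A (j % a)) × (i < j))))

-- A (a permutation of [a]) is nice corresponding to b (for a < b, a ∤ b),
-- with r = b mod a and d = gcd a b.
Nice : (a : ℕ) → .{{NonZero a}} → (b : ℕ) → (A : ℕ → ℕ) → Set
Nice a b A =
  (∀ i → i + (b % a) < a → A i < A (i + (b % a))) ×
  (∀ j → a ∸ (b % a) ≤ j → j + gcd a b < a → A j < A (j ∸ (a ∸ (b % a))))

-- Inside one residue class mod r the extension sequence A increases, which is the
-- first niceness condition for b (whose remainder mod a is r). For the second, write
-- j = k + (a − r) with k < r; then j ≡ k + a (mod r), and niceness of R for a says exactly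
-- that R k < R ((k + a) mod r) whenever k + gcd(r, a) < r. Complementing reverses this
-- inequality, and since gcd(r, a) divides b we have gcd(r, a) ≤ gcd(a, b), so the hypothesis
-- on k follows from j + gcd(a, b) < a.
module Submission where

open import Defs
open import Data.Nat using (ℕ; _<_; NonZero)
open import Data.Nat.DivMod using (_%_)
open import Data.Nat.Divisibility using (_∣_)
open import Relation.Binary.PropositionalEquality using (_≡_)
open import Relation.Nullary using (¬_)

open import Data.Nat using (suc; _+_; _∸_; _≤_; _<?_; s≤s⁻¹; ≢-nonZero; ≢-nonZero⁻¹; >-nonZero⁻¹)
open import Data.Nat.Properties
open import Data.Nat.DivMod using (m%n<n; m<n⇒m%n≡m; [m+n]%n≡m%n; %-distribˡ-+; m≤n⇒[n∸m]%m≡n%m)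
open import Data.Nat.Divisibility using (∣n∣m%n⇒∣m; ∣⇒≤)
open import Data.Nat.GCD using (gcd; gcd[m,n]∣m; gcd[m,n]∣n; gcd-greatest; gcd[m,n]≢0)
open import Data.Product using (_,_; proj₁; proj₂)
open import Data.Sum using (inj₁; inj₂)
open import Function.Bundles using (Equivalence)
open import Relation.Binary.PropositionalEquality using (sym; trans; cong; cong₂; subst; subst₂; module ≡-Reasoning)
open import Relation.Nullary using (yes; no)

variable
  a b m n i j k : ℕ
  A B R : ℕ → ℕ

complement-reverses-< : R i < m → R j < R i → complement m R i < complement m R j
complement-reverses-< {m = suc m} Ri<m Rj<Ri = ∸-monoʳ-< Rj<Ri (s≤s⁻¹ Ri<m)

module _ .{{_ : NonZero a}} (ext : IsExtensionSequence a A b B) where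

  extension-<-of-< : i < b → j < b → A (i % a) < A (j % a) → B i < B j
  extension-<-of-< {i} {j} i<b j<b lt =
    Equivalence.from (proj₂ ext i j i<b j<b) (inj₁ lt)

  extension-<-+modulus : i + a < b → B i < B (i + a)
  extension-<-+modulus {i} i+a<b =
    Equivalence.from (proj₂ ext i (i + a) (≤-<-trans (m≤m+n i a) i+a<b) i+a<b)
      (inj₂ (cong A (sym ([m+n]%n≡m%n i a)) , m<m+n i (>-nonZero⁻¹ a)))

module _ .{{_ : NonZero m}} where

  [k+n]%m≡[k+n%m]%m : k < m → (k + n) % m ≡ (k + n % m) % m
  [k+n]%m≡[k+n%m]%m {k} {n} k<m =
    trans (%-distribˡ-+ k n m) (cong (λ x → (x + n % m) % m) (m<n⇒m%n≡m k<m))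

  [k+n]%m≡k∸[m∸n%m] : k < m → m ≤ k + n % m → (k + n) % m ≡ k ∸ (m ∸ n % m)
  [k+n]%m≡k∸[m∸n%m] {k} {n} k<m m≤k+s = begin
    (k + n) % m           ≡⟨ [k+n]%m≡[k+n%m]%m k<m ⟩
    (k + s) % m           ≡⟨ m≤n⇒[n∸m]%m≡n%m m≤k+s ⟨
    (k + s ∸ m) % m       ≡⟨ m<n⇒m%n≡m k+s∸m<m ⟩
    k + s ∸ m             ≡⟨ cong₂ _∸_ (+-comm k s) (sym (m+[n∸m]≡n (<⇒≤ (m%n<n n m)))) ⟩
    s + k ∸ (s + (m ∸ s)) ≡⟨ [m+n]∸[m+o]≡n∸o s k (m ∸ s) ⟩
    k ∸ (m ∸ s)           ∎
    where
    open ≡-Reasoning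
    s = n % m
    k+s∸m<m : k + s ∸ m < m
    k+s∸m<m = ≤-<-trans
      (m≤n+o⇒m∸n≤o (k + s) m (≤-trans (+-monoʳ-≤ k (<⇒≤ (m%n<n n m))) (≤-reflexive (+-comm k m)))) k<m

  nice-rotate : Nice m n R → k + gcd m n < m → R k < R ((k + n) % m)
  nice-rotate {n} {R} {k} (shift , wrap) k+g<m with k + n % m <? m
  ... | yes k+s<m =
    subst (λ x → R k < R x) (sym (trans ([k+n]%m≡[k+n%m]%m (m+n≤o⇒m≤o (suc k) k+g<m)) (m<n⇒m%n≡m k+s<m)))
      (shift k k+s<m)
  ... | no k+s≮m =
    subst (λ x → R k < R x) (sym ([k+n]%m≡k∸[m∸n%m] (m+n≤o⇒m≤o (suc k) k+g<m) m≤k+s)) (wrap k m∸s≤k k+g<m)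
    where
    m≤k+s : m ≤ k + n % m
    m≤k+s = ≮⇒≥ k+s≮m
    m∸s≤k : m ∸ n % m ≤ k
    m∸s≤k = m≤n+o⇒m∸n≤o m (n % m) (≤-trans m≤k+s (≤-reflexive (+-comm k (n % m))))

gcd[n%m,m]≤gcd[m,n] : ∀ m n .{{_ : NonZero m}} → gcd (n % m) m ≤ gcd m n
gcd[n%m,m]≤gcd[m,n] m n = ∣⇒≤ {{≢-nonZero (gcd[m,n]≢0 m n (inj₁ (≢-nonZero⁻¹ m)))}}
  (gcd-greatest (gcd[m,n]∣n (n % m) m) (∣n∣m%n⇒∣m (gcd[m,n]∣n (n % m) m) (gcd[m,n]∣m (n % m) m)))

module _ {r a : ℕ} .{{_ : NonZero r}} (r<a : r < a) (R-perm : IsPermutation r R) (R-nice : Nice r a R)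
         (ext : IsExtensionSequence r (complement r R) a A) where

  extension-of-complement-wrap : a ∸ r ≤ j → j + gcd r a < a → A j < A (j ∸ (a ∸ r))
  extension-of-complement-wrap {j} a∸r≤j j+g<a =
    extension-<-of-< {A = complement r R} ext j<a k₀<a
      (complement-reverses-< {R = R} (proj₁ R-perm _ (m%n<n j r)) R[k₀%r]<R[j%r])
    where
    k₀ = j ∸ (a ∸ r)
    k₀+[a∸r]≡j : k₀ + (a ∸ r) ≡ j
    k₀+[a∸r]≡j = m∸n+n≡m a∸r≤j
    j<a : j < a
    j<a = m+n≤o⇒m≤o (suc j) j+g<a
    k₀+g<r : k₀ + gcd r a < r
    k₀+g<r = +-cancelˡ-< (a ∸ r) (k₀ + gcd r a) r (begin-strict
      (a ∸ r) + (k₀ + gcd r a) ≡⟨ +-assoc (a ∸ r) k₀ (gcd r a) ⟨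
      (a ∸ r) + k₀ + gcd r a   ≡⟨ cong (_+ gcd r a) (trans (+-comm (a ∸ r) k₀) k₀+[a∸r]≡j) ⟩
      j + gcd r a              <⟨ j+g<a ⟩
      a                        ≡⟨ m∸n+n≡m (<⇒≤ r<a) ⟨
      (a ∸ r) + r              ∎)
      where open ≤-Reasoning
    k₀<a : k₀ < a
    k₀<a = <-trans (m+n≤o⇒m≤o (suc k₀) k₀+g<r) r<a
    j%r≡[k₀+a]%r : j % r ≡ (k₀ + a) % r
    j%r≡[k₀+a]%r = begin
      j % r                  ≡⟨ [m+n]%n≡m%n j r ⟨
      (j + r) % r            ≡⟨ cong (λ x → (x + r) % r) k₀+[a∸r]≡j ⟨
      (k₀ + (a ∸ r) + r) % r ≡⟨ cong (_% r) (trans (+-assoc k₀ (a ∸ r) r) (cong (k₀ +_) (m∸n+n≡m (<⇒≤ r<a)))) ⟩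
      (k₀ + a) % r           ∎
      where open ≡-Reasoning
    R[k₀%r]<R[j%r] : R (k₀ % r) < R (j % r)
    R[k₀%r]<R[j%r] = subst₂ (λ x y → R x < R y)
      (sym (m<n⇒m%n≡m (m+n≤o⇒m≤o (suc k₀) k₀+g<r))) (sym j%r≡[k₀+a]%r) (nice-rotate R-nice k₀+g<r)

proposition2p6 : (r a : ℕ) → .{{_ : NonZero r}} → .{{_ : NonZero a}} →
    r < a → ¬ (r ∣ a) →
    (R : ℕ → ℕ) → IsPermutation r R → Nice r a R →
    (A : ℕ → ℕ) → IsExtensionSequence r (complement r R) a A →
    (b : ℕ) → a < b → b % a ≡ r → Nice a b A
proposition2p6 r a r<a _ R R-perm R-nice A ext b _ b%a≡r = shift , wrap
  where
  gcd[r,a]≤gcd[a,b] : gcd r a ≤ gcd a b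
  gcd[r,a]≤gcd[a,b] = subst (λ x → gcd x a ≤ gcd a b) b%a≡r (gcd[n%m,m]≤gcd[m,n] a b)

  shift : ∀ i → i + b % a < a → A i < A (i + b % a)
  shift i rewrite b%a≡r = extension-<-+modulus {A = complement r R} ext

  wrap : ∀ j → a ∸ b % a ≤ j → j + gcd a b < a → A j < A (j ∸ (a ∸ b % a))
  wrap j rewrite b%a≡r = λ a∸r≤j j+gcd[a,b]<a →
    extension-of-complement-wrap r<a R-perm R-nice ext a∸r≤j
      (≤-<-trans (+-monoʳ-≤ j gcd[r,a]≤gcd[a,b]) j+gcd[a,b]<a)
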